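{- The class of biconvex graphs that contain neither $P_8$ nor $\widetilde{P}_8$ as an induced subgraph is not well-quasi-ordered by the induced subgraph relation; that is, it contains an infinite antichain with respect to the induced subgraph relation.
   Context: All graphs are finite, simple and undirected. $P_k$ denotes the chordless path on $k$ vertices. For a bipartite graph $G=(V_1,V_2,E)$ with parts $V_1,V_2$, its bipartite complement is $\widetilde{G}=(V_1,V_2,(V_1\times V_2)\setminus E)$; $\widetilde{P}_8$ is the bipartite complement of $P_8$ (with respect to its unique bipartition). A bipartite graph with parts $X,Y$ is biconvex if $X$ and $Y$ can each be linearly ordered so that the neighborhood of every vertex consists of consecutive vertices in the order of the opposite part. A class of graphs is well-quasi-ordered by the induced subgraph relation if it contains no infinite strictly decreasing sequence and no infinite antichain, where an antichain is a set of graphs pairwise incomparable under the relation "is isomorphic to an induced subgraph of". -}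

module Defs where

open import Data.Nat using (ℕ; zero; suc; _≡ᵇ_; _≤_)
open import Data.Fin using (Fin; toℕ)
open import Data.Bool using (Bool; true; false; not; _∧_; _∨_; _xor_)
open import Data.Bool.Properties using (∨-comm; xor-same)
open import Data.Product using (Σ; _×_; _,_)
open import Relation.Binary.PropositionalEquality using (_≡_; _≢_; refl; cong₂)
open import Relation.Nullary using (¬_)

record Graph : Set where
  field
    n      : ℕ
    adj    : Fin n → Fin n → Bool
    sym    : ∀ i j → adj i j ≡ adj j i
    irrefl : ∀ i → adj i i ≡ false
open Graph public

_≤ᵢ_ : Graph → Graph → Set
H ≤ᵢ G = Σ (Fin (n H) → Fin (n G)) λ f →
           (∀ i j → f i ≡ f j → i ≡ j) ×
           (∀ i j → adj G (f i) (f j) ≡ adj H i j)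

private
  ≡ᵇ-suc : ∀ m → (m ≡ᵇ suc m) ≡ false
  ≡ᵇ-suc zero = refl
  ≡ᵇ-suc (suc m) = ≡ᵇ-suc m

  pathAdj : ∀ {k} → Fin k → Fin k → Bool
  pathAdj i j = (toℕ i ≡ᵇ suc (toℕ j)) ∨ (toℕ j ≡ᵇ suc (toℕ i))

P : ℕ → Graph
P k = record
  { n = k
  ; adj = pathAdj
  ; sym = λ i j → ∨-comm (toℕ i ≡ᵇ suc (toℕ j)) (toℕ j ≡ᵇ suc (toℕ i))
  ; irrefl = λ i → cong₂ _∨_ (≡ᵇ-suc (toℕ i)) (≡ᵇ-suc (toℕ i))
  }

bipComplement : (G : Graph) → (Fin (n G) → Bool) → Graph
bipComplement G c = record
  { n = n G
  ; adj = λ i j → (c i xor c j) ∧ not (adj G i j)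
  ; sym = λ i j → cong₂ (λ a b → a ∧ not b) (xor-comm (c i) (c j)) (Graph.sym G i j)
  ; irrefl = λ i → cong₂ (λ a b → a ∧ not b) (xor-same (c i)) refl
  }
  where
  xor-comm : ∀ a b → (a xor b) ≡ (b xor a)
  xor-comm true true = refl
  xor-comm true false = refl
  xor-comm false true = refl
  xor-comm false false = refl

parity : ℕ → Bool
parity zero = false
parity (suc m) = not (parity m)

-- P̃_8: bipartite complement of P_8 w.r.t. its unique bipartition (even/odd vertices).
P̃8 : Graph
P̃8 = bipComplement (P 8) (λ i → parity (toℕ i))

-- G is biconvex: there is a bipartition (colouring c, every edge joins the two
-- colour classes) and linear orders on both parts (given by an injective rank r,
-- restricted to each part) such that the neighbourhood of every vertex v is
-- consecutive in the order of the part opposite to v.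
Biconvex : Graph → Set
Biconvex G =
  Σ (Fin (n G) → Bool) λ c →
  (∀ i j → adj G i j ≡ true → c i ≢ c j) ×
  Σ (Fin (n G) → ℕ) λ r →
  (∀ i j → r i ≡ r j → i ≡ j) ×
  (∀ v u w z → c u ≢ c v → c w ≢ c v → c z ≢ c v →
     adj G v u ≡ true → adj G v w ≡ true →
     r u ≤ r z → r z ≤ r w → adj G v z ≡ true)

InClass : Graph → Set
InClass G = Biconvex G × ¬ (P 8 ≤ᵢ G) × ¬ (P̃8 ≤ᵢ G)

InfiniteAntichainIn : (Graph → Set) → Set
InfiniteAntichainIn C =
  Σ (ℕ → Graph) λ A → (∀ i → C (A i)) × (∀ i j → i ≢ j → ¬ (A i ≤ᵢ A j))

module Submission where

-- The class of biconvex graphs without induced P₈ and P̃₈ contains an infinite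
-- antichain: the graphs Γ n (n ≥ 3).  Γ n is bipartite with parts x_0 … x_n
-- and y_0 … y_n, where x_i ~ y_j iff i < j (a half graph), i = j + 2 (the
-- "back" edges) or i = j with 0 < i < n (the inner diagonal).
--
-- 1. Induced 2K₂'s (and their analogue for the bipartite complement) are
--    carried along induced embeddings.  This gives criteria: if the edges
--    having two different 2K₂-partners are "special" and special edges form
--    a matching, then G is P₈-free; similarly for P̃₈.
-- 2. Bipartite graphs given by a relation: crossing pairs and their indices,
--    and a biconvexity criterion via separation of non-neighbours.
-- 3. The arithmetic of the index relation of Γ n: which index pairs can be
--    2K₂-partners of which.
-- 4. Parity-based orders on both parts, which make Γ n biconvex.
-- 5. Γ n is in the class: the special edges are the back edges (for P₈) and
--    the pairs x_{j+1} y_j (for P̃₈).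
-- 6. Γ a does not embed into Γ b for 3 ≤ a < b: back edges must map to back
--    edges along a path of rows too short to join the two extreme rows.
-- The theorem follows; the reverse embeddings fail by counting vertices.

open import Defs hiding (sym)
open import Data.Nat using (ℕ; zero; suc; _+_; _*_; _∸_; _≤_; _<_; z≤n; s≤s; _<?_; _≟_; _≤?_)
open import Data.Nat.Properties
open import Data.Bool using (Bool; true; false; not; _∧_; _∨_; if_then_else_)
open import Data.Bool.Properties using (not-¬)
open import Data.Fin using (Fin; toℕ; #_; fromℕ<; splitAt; _↑ˡ_; _↑ʳ_)
import Data.Fin as Fin
open import Data.Fin.Properties using (injective⇒≤; splitAt-↑ˡ; splitAt-↑ʳ; splitAt⁻¹-↑ˡ; splitAt⁻¹-↑ʳ; toℕ-injective; ↑ˡ-injective; ↑ʳ-injective; toℕ<n; toℕ-fromℕ<)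
open import Data.Empty using (⊥; ⊥-elim)
open import Data.Product using (Σ; _×_; _,_; proj₁; proj₂)
import Data.Product as Prod
open import Data.Sum using (_⊎_; inj₁; inj₂)
import Data.Sum as Sum
open import Relation.Binary using (tri<; tri≈; tri>)
open import Relation.Binary.PropositionalEquality using (_≡_; _≢_; refl; sym; trans; cong; cong₂; subst; subst₂)
open import Relation.Nullary using (¬_; yes; no)
open import Relation.Nullary.Decidable using (⌊_⌋)

record Induced2K2 (G : Graph) (u v w z : Fin (n G)) : Set where
  constructor induced2K2
  field
    edge₁ : adj G u v ≡ true
    edge₂ : adj G w z ≡ true
    uw    : adj G u w ≡ false
    uz    : adj G u z ≡ false
    vw    : adj G v w ≡ false
    vz    : adj G v z ≡ false
open Induced2K2 public

2K2-swap : ∀ {G u v w z} → Induced2K2 G u v w z → Induced2K2 G w z u v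
2K2-swap {G} {u} {v} {w} {z} (induced2K2 e₁ e₂ uw uz vw vz) =
  induced2K2 e₂ e₁ (trans (Graph.sym G w u) uw) (trans (Graph.sym G w v) vw)
                   (trans (Graph.sym G z u) uz) (trans (Graph.sym G z v) vz)

-- In a bipartite graph
-- these are exactly the induced 2K₂'s of the bipartite complement.
record InducedCo2K2 (G : Graph) (c : Fin (n G) → Bool) (u v w z : Fin (n G)) : Set where
  constructor inducedCo2K2
  field
    opposite  : c u ≡ not (c v)
    nonEdge₁  : adj G u v ≡ false
    nonEdge₂  : adj G w z ≡ false
    uz        : adj G u z ≡ true
    vw        : adj G v w ≡ true
open InducedCo2K2 public

SamePair : ∀ {A : Set} → A → A → A → A → Set
SamePair w z w' z' = (w ≡ w' × z ≡ z') ⊎ (w ≡ z' × z ≡ w')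

2K2-image : ∀ {H G} ((f , _ , pres) : H ≤ᵢ G) {u v w z} →
            Induced2K2 H u v w z → Induced2K2 G (f u) (f v) (f w) (f z)
2K2-image (f , _ , pres) {u} {v} {w} {z} (induced2K2 e₁ e₂ uw uz vw vz) =
  induced2K2 (trans (pres u v) e₁) (trans (pres w z) e₂) (trans (pres u w) uw)
             (trans (pres u z) uz) (trans (pres v w) vw) (trans (pres v z) vz)

embedding-size : ∀ {H G} → H ≤ᵢ G → n H ≤ n G
embedding-size (f , f-injective , _) = injective⇒≤ (λ {u} {v} → f-injective u v)

distinct-pairs : ∀ {A B : Set} {f : A → B} → (∀ i j → f i ≡ f j → i ≡ j) →
                 ∀ {w z w' z'} → w ≢ w' ⊎ z ≢ z' → w ≢ z' →
                 ¬ SamePair (f w) (f z) (f w') (f z')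
distinct-pairs inj (inj₁ w≢w') _ (inj₁ (e , _)) = w≢w' (inj _ _ e)
distinct-pairs inj (inj₂ z≢z') _ (inj₁ (_ , e)) = z≢z' (inj _ _ e)
distinct-pairs inj _ w≢z' (inj₂ (e , _)) = w≢z' (inj _ _ e)

-- In P₈ the edges
-- 01 and 12 both have two partners (34, 45 and 45, 56), and they share the
-- vertex 1; so P₈ cannot be an induced subgraph of G.
P8-free-criterion : (G : Graph) (Special : Fin (n G) → Fin (n G) → Set) →
  (∀ {u v w z w' z'} → Induced2K2 G u v w z → Induced2K2 G u v w' z' →
     Special u v ⊎ SamePair w z w' z') →
  (∀ {u v} → Special u v → Special v u) →
  (∀ {u v w} → Special u v → Special u w → v ≡ w) →
  ¬ (P 8 ≤ᵢ G)
P8-free-criterion G Special two-partners special-sym special-functional emb@(f , inj , _)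
  with two-partners (image q₀₁₃₄) (image q₀₁₄₅) | two-partners (image q₁₂₄₅) (image q₁₂₅₆)
  where
  image : ∀ {a b c d} → Induced2K2 (P 8) a b c d → Induced2K2 G (f a) (f b) (f c) (f d)
  image = 2K2-image emb
  q₀₁₃₄ : Induced2K2 (P 8) (# 0) (# 1) (# 3) (# 4)
  q₀₁₃₄ = induced2K2 refl refl refl refl refl refl
  q₀₁₄₅ : Induced2K2 (P 8) (# 0) (# 1) (# 4) (# 5)
  q₀₁₄₅ = induced2K2 refl refl refl refl refl refl
  q₁₂₄₅ : Induced2K2 (P 8) (# 1) (# 2) (# 4) (# 5)
  q₁₂₄₅ = induced2K2 refl refl refl refl refl refl
  q₁₂₅₆ : Induced2K2 (P 8) (# 1) (# 2) (# 5) (# 6)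
  q₁₂₅₆ = induced2K2 refl refl refl refl refl refl
... | inj₂ same | _ = distinct-pairs inj (inj₁ (λ ())) (λ ()) same
... | inj₁ _ | inj₂ same = distinct-pairs inj (inj₁ (λ ())) (λ ()) same
... | inj₁ s₀₁ | inj₁ s₁₂ with inj _ _ (special-functional (special-sym s₀₁) s₁₂)
...   | ()

colour-twice : ∀ {x y z : Bool} → x ≡ not y → y ≡ not z → x ≡ z
colour-twice {y = true}  {false} refl refl = refl
colour-twice {y = false} {true}  refl refl = refl

-- In P̃₈ the non-edges 01 and 12 of the complement have the
-- partners 43, 45 and 54, 56 (vertices 0, 1, 2 get alternating colours,
-- witnessed by the paths 0-5-2-7-4-1 and 1-4-7-2 of P̃₈).
P̃8-free-criterion : (G : Graph) (c : Fin (n G) → Bool) →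
  (∀ u v → adj G u v ≡ true → c u ≡ not (c v)) →
  (Special : Fin (n G) → Fin (n G) → Set) →
  (∀ {u v w z w' z'} → InducedCo2K2 G c u v w z → InducedCo2K2 G c u v w' z' →
     Special u v ⊎ SamePair w z w' z') →
  (∀ {u v} → Special u v → Special v u) →
  (∀ {u v w} → Special u v → Special u w → v ≡ w) →
  ¬ (P̃8 ≤ᵢ G)
P̃8-free-criterion G c proper Special two-partners special-sym special-functional (f , inj , pres)
  with two-partners (image (# 4) (# 3) c₀₁ refl refl refl refl) (image (# 4) (# 5) c₀₁ refl refl refl refl)
     | two-partners (image (# 5) (# 4) c₁₂ refl refl refl refl) (image (# 5) (# 6) c₁₂ refl refl refl refl)
  where
  flip : ∀ a b → adj P̃8 a b ≡ true → c (f a) ≡ not (c (f b))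
  flip a b e = proper (f a) (f b) (trans (pres a b) e)
  c₀₁ : c (f (# 0)) ≡ not (c (f (# 1)))
  c₀₁ = trans (colour-twice (flip (# 0) (# 5) refl) (flip (# 5) (# 2) refl))
       (trans (colour-twice (flip (# 2) (# 7) refl) (flip (# 7) (# 4) refl)) (flip (# 4) (# 1) refl))
  c₁₂ : c (f (# 1)) ≡ not (c (f (# 2)))
  c₁₂ = trans (colour-twice (flip (# 1) (# 4) refl) (flip (# 4) (# 7) refl)) (flip (# 7) (# 2) refl)
  image : ∀ {a b} d e → c (f a) ≡ not (c (f b)) →
          adj P̃8 a b ≡ false → adj P̃8 d e ≡ false → adj P̃8 a e ≡ true → adj P̃8 b d ≡ true →
          InducedCo2K2 G c (f a) (f b) (f d) (f e)
  image d e cr ab de ae bd =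
    inducedCo2K2 cr (trans (pres _ _) ab) (trans (pres _ _) de) (trans (pres _ _) ae) (trans (pres _ _) bd)
... | inj₂ same | _ = distinct-pairs inj {# 4} {# 3} {# 4} {# 5} (inj₂ (λ ())) (λ ()) same
... | inj₁ _ | inj₂ same = distinct-pairs inj {# 5} {# 4} {# 5} {# 6} (inj₂ (λ ())) (λ ()) same
... | inj₁ s₀₁ | inj₁ s₁₂ with inj _ _ (special-functional (special-sym s₀₁) s₁₂)
...   | ()

data Separated {B : Set} (ρ : B → ℕ) (N : B → Set) (b₀ : B) : Set where
  all-below : (∀ b → N b → ρ b < ρ b₀) → Separated ρ N b₀
  all-above : (∀ b → N b → ρ b₀ < ρ b) → Separated ρ N b₀

convex-from-separation : ∀ {B : Set} (ρ : B → ℕ) (N : B → Bool) →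
  (∀ b₀ → N b₀ ≡ false → Separated ρ (λ b → N b ≡ true) b₀) →
  ∀ {b₁ b₂ b₀} → N b₁ ≡ true → N b₂ ≡ true → ρ b₁ ≤ ρ b₀ → ρ b₀ ≤ ρ b₂ → N b₀ ≡ true
convex-from-separation ρ N separated {b₁} {b₂} {b₀} n₁ n₂ le₁ le₂ with N b₀ in e
... | true = refl
... | false with separated b₀ e
...   | all-below below = ⊥-elim (<⇒≱ (below b₂ n₂) le₂)
...   | all-above above = ⊥-elim (<⇒≱ (above b₁ n₁) le₁)

Beyond : Bool → ℕ → ℕ → Set
Beyond true  a b = a < b
Beyond false a b = b < a

beyond-separated : ∀ {B : Set} (ρ : B → ℕ) {N : B → Set} {b₀} (above : Bool) →
  (∀ b → N b → Beyond above (ρ b₀) (ρ b)) → Separated ρ N b₀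
beyond-separated ρ true  beyond = all-above beyond
beyond-separated ρ false beyond = all-below beyond

-- The bipartite graph with parts X = Fin p and Y = Fin q in which x_i ~ y_j
-- iff R i j; its vertex set Fin (p + q) lists X before Y.
module Bipartite {p q : ℕ} (R : Fin p → Fin q → Bool) where

  link : Fin p ⊎ Fin q → Fin p ⊎ Fin q → Bool
  link (inj₁ i) (inj₂ j) = R i j
  link (inj₂ j) (inj₁ i) = R i j
  link (inj₁ _) (inj₁ _) = false
  link (inj₂ _) (inj₂ _) = false

  link-sym : ∀ s t → link s t ≡ link t s
  link-sym (inj₁ _) (inj₁ _) = refl
  link-sym (inj₁ _) (inj₂ _) = refl
  link-sym (inj₂ _) (inj₁ _) = refl
  link-sym (inj₂ _) (inj₂ _) = refl

  link-irrefl : ∀ s → link s s ≡ false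
  link-irrefl (inj₁ _) = refl
  link-irrefl (inj₂ _) = refl

  graph : Graph
  graph = record
    { n      = p + q
    ; adj    = λ u v → link (splitAt p u) (splitAt p v)
    ; sym    = λ u v → link-sym (splitAt p u) (splitAt p v)
    ; irrefl = λ u → link-irrefl (splitAt p u)
    }

  V : Set
  V = Fin (p + q)

  A : V → V → Bool
  A = adj graph

  X : Fin p → V
  X i = i ↑ˡ q

  Y : Fin q → V
  Y j = p ↑ʳ j

  side : V → Bool
  side v with splitAt p v
  ... | inj₁ _ = true
  ... | inj₂ _ = false

  view : (v : V) → (Σ (Fin p) λ i → v ≡ X i) ⊎ (Σ (Fin q) λ j → v ≡ Y j)
  view v with splitAt p v in e
  ... | inj₁ i = inj₁ (i , sym (splitAt⁻¹-↑ˡ e))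
  ... | inj₂ j = inj₂ (j , sym (splitAt⁻¹-↑ʳ e))

  adj-XY : ∀ i j → A (X i) (Y j) ≡ R i j
  adj-XY i j rewrite splitAt-↑ˡ p i q | splitAt-↑ʳ p q j = refl

  adj-YX : ∀ j i → A (Y j) (X i) ≡ R i j
  adj-YX j i rewrite splitAt-↑ˡ p i q | splitAt-↑ʳ p q j = refl

  adj-XX : ∀ i i' → A (X i) (X i') ≡ false
  adj-XX i i' rewrite splitAt-↑ˡ p i q | splitAt-↑ˡ p i' q = refl

  adj-YY : ∀ j j' → A (Y j) (Y j') ≡ false
  adj-YY j j' rewrite splitAt-↑ʳ p q j | splitAt-↑ʳ p q j' = refl

  side-X : ∀ i → side (X i) ≡ true
  side-X i rewrite splitAt-↑ˡ p i q = refl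

  side-Y : ∀ j → side (Y j) ≡ false
  side-Y j rewrite splitAt-↑ʳ p q j = refl

  X-injective : ∀ {i i'} → X i ≡ X i' → i ≡ i'
  X-injective = ↑ˡ-injective q _ _

  Y-injective : ∀ {j j'} → Y j ≡ Y j' → j ≡ j'
  Y-injective = ↑ʳ-injective p _ _

  X≢Y : ∀ i j → X i ≢ Y j
  X≢Y i j e with trans (sym (side-X i)) (trans (cong side e) (side-Y j))
  ... | ()

  edges-cross : ∀ u v → A u v ≡ true → side u ≡ not (side v)
  edges-cross u v e with splitAt p u | splitAt p v
  edges-cross u v () | inj₁ _ | inj₁ _
  edges-cross u v _  | inj₁ _ | inj₂ _ = refl
  edges-cross u v _  | inj₂ _ | inj₁ _ = refl
  edges-cross u v () | inj₂ _ | inj₂ _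

  record Crossing (u v : V) : Set where
    constructor crossing
    field
      row : Fin p
      col : Fin q
      ends : (u ≡ X row × v ≡ Y col) ⊎ (u ≡ Y col × v ≡ X row)
  open Crossing public

  orient : ∀ u v → side u ≡ not (side v) → Crossing u v
  orient u v opp with view u | view v
  ... | inj₁ (i , refl) | inj₂ (j , refl) = crossing i j (inj₁ (refl , refl))
  ... | inj₂ (j , refl) | inj₁ (i , refl) = crossing i j (inj₂ (refl , refl))
  ... | inj₁ (i , refl) | inj₁ (i' , refl) with trans (sym (side-X i)) (trans opp (cong not (side-X i')))
  ...   | ()
  orient u v opp | inj₂ (j , refl) | inj₂ (j' , refl) with trans (sym (side-Y j)) (trans opp (cong not (side-Y j')))
  ...   | ()

  orient-edge : ∀ u v → A u v ≡ true → Crossing u v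
  orient-edge u v e = orient u v (edges-cross u v e)

  crossing-swap : ∀ {u v} → Crossing u v → Crossing v u
  crossing-swap (crossing i j ends) = crossing i j (Sum.swap (Sum.map Prod.swap Prod.swap ends))

  crossing-adj : ∀ {u v} (o : Crossing u v) → A u v ≡ R (row o) (col o)
  crossing-adj (crossing i j (inj₁ (refl , refl))) = adj-XY i j
  crossing-adj (crossing i j (inj₂ (refl , refl))) = adj-YX j i

  crossing-samePair : ∀ {w z w' z'} (o : Crossing w z) (o' : Crossing w' z') →
                      row o ≡ row o' → col o ≡ col o' → SamePair w z w' z'
  crossing-samePair (crossing i j (inj₁ (refl , refl))) (crossing .i .j (inj₁ (refl , refl))) refl refl = inj₁ (refl , refl)
  crossing-samePair (crossing i j (inj₁ (refl , refl))) (crossing .i .j (inj₂ (refl , refl))) refl refl = inj₂ (refl , refl)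
  crossing-samePair (crossing i j (inj₂ (refl , refl))) (crossing .i .j (inj₁ (refl , refl))) refl refl = inj₂ (refl , refl)
  crossing-samePair (crossing i j (inj₂ (refl , refl))) (crossing .i .j (inj₂ (refl , refl))) refl refl = inj₁ (refl , refl)

  crossing-row-unique : ∀ {u v} (o o' : Crossing u v) → row o ≡ row o'
  crossing-row-unique (crossing i j (inj₁ (refl , refl))) (crossing i' j' (inj₁ (e , _))) = X-injective e
  crossing-row-unique (crossing i j (inj₂ (refl , refl))) (crossing i' j' (inj₂ (_ , e))) = X-injective e
  crossing-row-unique (crossing i j (inj₁ (refl , refl))) (crossing i' j' (inj₂ (e , _))) = ⊥-elim (X≢Y i j' e)
  crossing-row-unique (crossing i j (inj₂ (refl , refl))) (crossing i' j' (inj₁ (e , _))) = ⊥-elim (X≢Y i' j (sym e))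

  row-end : ∀ {u v} (o : Crossing u v) → X (row o) ≡ u ⊎ X (row o) ≡ v
  row-end (crossing i j (inj₁ (refl , refl))) = inj₁ refl
  row-end (crossing i j (inj₂ (refl , refl))) = inj₂ refl

  crossing-end : ∀ {c w z} (o : Crossing w z) → c ≡ w ⊎ c ≡ z → c ≡ X (row o) ⊎ c ≡ Y (col o)
  crossing-end (crossing i j (inj₁ (refl , refl))) (inj₁ e) = inj₁ e
  crossing-end (crossing i j (inj₁ (refl , refl))) (inj₂ e) = inj₂ e
  crossing-end (crossing i j (inj₂ (refl , refl))) (inj₁ e) = inj₂ e
  crossing-end (crossing i j (inj₂ (refl , refl))) (inj₂ e) = inj₁ e

  2K2-nonlinks : ∀ {u v w z} → Induced2K2 graph u v w z → (o₁ : Crossing u v) (o₂ : Crossing w z) →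
                 R (row o₁) (col o₂) ≡ false × R (row o₂) (col o₁) ≡ false
  2K2-nonlinks q (crossing i j (inj₁ (refl , refl))) (crossing k l (inj₁ (refl , refl))) =
    trans (sym (adj-XY i l)) (uz q) , trans (sym (adj-YX j k)) (vw q)
  2K2-nonlinks q (crossing i j (inj₁ (refl , refl))) (crossing k l (inj₂ (refl , refl))) =
    trans (sym (adj-XY i l)) (uw q) , trans (sym (adj-YX j k)) (vz q)
  2K2-nonlinks q (crossing i j (inj₂ (refl , refl))) (crossing k l (inj₁ (refl , refl))) =
    trans (sym (adj-XY i l)) (vz q) , trans (sym (adj-YX j k)) (uw q)
  2K2-nonlinks q (crossing i j (inj₂ (refl , refl))) (crossing k l (inj₂ (refl , refl))) =
    trans (sym (adj-XY i l)) (vw q) , trans (sym (adj-YX j k)) (uz q)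

  co2K2-crossing : ∀ {u v w z} → InducedCo2K2 graph side u v w z → side w ≡ not (side z)
  co2K2-crossing {u} {v} {w} {z} q
    with side u | side v | side w | side z | opposite q | edges-cross u z (uz q) | edges-cross v w (vw q)
  ... | true  | false | true  | false | _ | _ | _ = refl
  ... | false | true  | false | true  | _ | _ | _ = refl

  co2K2-links : ∀ {u v w z} → InducedCo2K2 graph side u v w z → (o₁ : Crossing u v) (o₂ : Crossing w z) →
                R (row o₁) (col o₂) ≡ true × R (row o₂) (col o₁) ≡ true
  co2K2-links q (crossing i j (inj₁ (refl , refl))) (crossing k l (inj₁ (refl , refl))) =
    trans (sym (adj-XY i l)) (uz q) , trans (sym (adj-YX j k)) (vw q)
  co2K2-links q (crossing i j (inj₁ (refl , refl))) (crossing k l (inj₂ (refl , refl)))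
    with trans (sym (uz q)) (adj-XX i k)
  ... | ()
  co2K2-links q (crossing i j (inj₂ (refl , refl))) (crossing k l (inj₁ (refl , refl)))
    with trans (sym (uz q)) (adj-YY j l)
  ... | ()
  co2K2-links q (crossing i j (inj₂ (refl , refl))) (crossing k l (inj₂ (refl , refl))) =
    trans (sym (adj-XY i l)) (vw q) , trans (sym (adj-YX j k)) (uz q)

  Marked : (ℕ → ℕ → Set) → V → V → Set
  Marked S u v = Σ (Crossing u v) λ o → S (toℕ (row o)) (toℕ (col o))

  marked-swap : ∀ {S u v} → Marked S u v → Marked S v u
  marked-swap (o , s) = crossing-swap o , s

  module Matching {S : ℕ → ℕ → Set}
           (col-det : ∀ {i j j'} → S i j → S i j' → j ≡ j')
           (row-det : ∀ {i i' j} → S i j → S i' j → i ≡ i') where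

    marked-shared : ∀ {w z w' z' c} → Marked S w z → Marked S w' z' →
                    c ≡ w ⊎ c ≡ z → c ≡ w' ⊎ c ≡ z' → SamePair w z w' z'
    marked-shared (o , s) (o' , s') c∈o c∈o' with crossing-end o c∈o | crossing-end o' c∈o'
    ... | inj₁ c≡x | inj₁ c≡x' with X-injective (trans (sym c≡x) c≡x')
    ...   | rows = crossing-samePair o o' rows (toℕ-injective (col-det s (subst (λ r → S (toℕ r) _) (sym rows) s')))
    marked-shared (o , s) (o' , s') c∈o c∈o' | inj₂ c≡y | inj₂ c≡y' with Y-injective (trans (sym c≡y) c≡y')
    ...   | cols = crossing-samePair o o' (toℕ-injective (row-det s (subst (λ k → S _ (toℕ k)) (sym cols) s'))) cols
    marked-shared (o , _) (o' , _) _ _ | inj₁ c≡x | inj₂ c≡y' = ⊥-elim (X≢Y _ _ (trans (sym c≡x) c≡y'))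
    marked-shared (o , _) (o' , _) _ _ | inj₂ c≡y | inj₁ c≡x' = ⊥-elim (X≢Y _ _ (trans (sym c≡x') c≡y))

    marked-functional : ∀ {u v w} → Marked S u v → Marked S u w → v ≡ w
    marked-functional m m' with marked-shared m m' (inj₁ refl) (inj₁ refl)
    ... | inj₁ (_ , v≡w) = v≡w
    ... | inj₂ (u≡w , v≡u) = trans v≡u u≡w

  -- Ranks of all vertices: X-vertices get even, Y-vertices odd numbers, so
  -- that orders on the two parts combine into one injective rank.
  module Ranked (ρX : Fin p → ℕ) (ρY : Fin q → ℕ) where

    rank : V → ℕ
    rank v with splitAt p v
    ... | inj₁ i = 2 * ρX i
    ... | inj₂ j = suc (2 * ρY j)

    rank-X : ∀ i → rank (X i) ≡ 2 * ρX i
    rank-X i rewrite splitAt-↑ˡ p i q = refl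

    rank-Y : ∀ j → rank (Y j) ≡ suc (2 * ρY j)
    rank-Y j rewrite splitAt-↑ʳ p q j = refl

    rank-injective : (∀ {i i'} → ρX i ≡ ρX i' → i ≡ i') → (∀ {j j'} → ρY j ≡ ρY j' → j ≡ j') →
                     ∀ u v → rank u ≡ rank v → u ≡ v
    rank-injective ρX-inj ρY-inj u v e with view u | view v
    ... | inj₁ (i , refl) | inj₁ (i' , refl) =
      cong X (ρX-inj (*-cancelˡ-≡ _ _ 2 (trans (sym (rank-X i)) (trans e (rank-X i')))))
    ... | inj₂ (j , refl) | inj₂ (j' , refl) =
      cong Y (ρY-inj (*-cancelˡ-≡ _ _ 2 (suc-injective (trans (sym (rank-Y j)) (trans e (rank-Y j'))))))
    ... | inj₁ (i , refl) | inj₂ (j , refl) = ⊥-elim (even≢odd (ρX i) (ρY j) (trans (sym (rank-X i)) (trans e (rank-Y j))))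
    ... | inj₂ (j , refl) | inj₁ (i , refl) = ⊥-elim (even≢odd (ρX i) (ρY j) (trans (sym (rank-X i)) (trans (sym e) (rank-Y j))))

    rank-X-≤ : ∀ {i i'} → rank (X i) ≤ rank (X i') → ρX i ≤ ρX i'
    rank-X-≤ {i} {i'} le = *-cancelˡ-≤ 2 (subst₂ _≤_ (rank-X i) (rank-X i') le)

    rank-Y-≤ : ∀ {j j'} → rank (Y j) ≤ rank (Y j') → ρY j ≤ ρY j'
    rank-Y-≤ {j} {j'} le = *-cancelˡ-≤ 2 (≤-pred (subst₂ _≤_ (rank-Y j) (rank-Y j') le))

  biconvex-criterion : (ρX : Fin p → ℕ) (ρY : Fin q → ℕ) →
    (∀ {i i'} → ρX i ≡ ρX i' → i ≡ i') → (∀ {j j'} → ρY j ≡ ρY j' → j ≡ j') →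
    (∀ i j₀ → R i j₀ ≡ false → Separated ρY (λ j → R i j ≡ true) j₀) →
    (∀ i₀ j → R i₀ j ≡ false → Separated ρX (λ i → R i j ≡ true) i₀) →
    Biconvex graph
  biconvex-criterion ρX ρY ρX-inj ρY-inj sepY sepX =
    side , proper , rank , rank-injective ρX-inj ρY-inj , convex
    where
    open Ranked ρX ρY
    proper : ∀ u v → A u v ≡ true → side u ≢ side v
    proper u v e same = not-¬ same (edges-cross u v e)
    convex : ∀ v u w z → side u ≢ side v → side w ≢ side v → side z ≢ side v →
             A v u ≡ true → A v w ≡ true → rank u ≤ rank z → rank z ≤ rank w → A v z ≡ true
    convex v u w z su sw sz vu vw uz zw with view v | view u | view w | view z
    ... | inj₁ (i , refl) | inj₂ (j₁ , refl) | inj₂ (j₂ , refl) | inj₂ (j , refl) =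
      trans (adj-XY i j) (convex-from-separation ρY (R i) (sepY i)
        (trans (sym (adj-XY i j₁)) vu) (trans (sym (adj-XY i j₂)) vw) (rank-Y-≤ uz) (rank-Y-≤ zw))
    ... | inj₂ (j , refl) | inj₁ (i₁ , refl) | inj₁ (i₂ , refl) | inj₁ (i , refl) =
      trans (adj-YX j i) (convex-from-separation ρX (λ i' → R i' j) (λ i₀ → sepX i₀ j)
        (trans (sym (adj-YX j i₁)) vu) (trans (sym (adj-YX j i₂)) vw) (rank-X-≤ uz) (rank-X-≤ zw))
    ... | inj₁ (i , refl) | inj₁ (i' , refl) | _ | _ = ⊥-elim (su (trans (side-X i') (sym (side-X i))))
    ... | inj₁ (i , refl) | _ | inj₁ (i' , refl) | _ = ⊥-elim (sw (trans (side-X i') (sym (side-X i))))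
    ... | inj₁ (i , refl) | _ | _ | inj₁ (i' , refl) = ⊥-elim (sz (trans (side-X i') (sym (side-X i))))
    ... | inj₂ (j , refl) | inj₂ (j' , refl) | _ | _ = ⊥-elim (su (trans (side-Y j') (sym (side-Y j))))
    ... | inj₂ (j , refl) | _ | inj₂ (j' , refl) | _ = ⊥-elim (sw (trans (side-Y j') (sym (side-Y j))))
    ... | inj₂ (j , refl) | _ | _ | inj₂ (j' , refl) = ⊥-elim (sz (trans (side-Y j') (sym (side-Y j))))

linked : ℕ → ℕ → ℕ → Bool
linked n i j = ⌊ i <? j ⌋ ∨ (⌊ i ≟ suc (suc j) ⌋ ∨ (⌊ i ≟ j ⌋ ∧ (⌊ 0 <? i ⌋ ∧ ⌊ i <? n ⌋)))

data Linked (n i j : ℕ) : Set where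
  asc  : i < j → Linked n i j
  back : i ≡ suc (suc j) → Linked n i j
  diag : i ≡ j → 0 < i → i < n → Linked n i j

record Unlinked (n i j : ℕ) : Set where
  constructor unlinked
  field
    col≤row  : j ≤ i
    not-back : i ≢ suc (suc j)
    diag-end : i ≡ j → i ≡ 0 ⊎ n ≤ i
open Unlinked public

linked⇒Linked : ∀ n i j → linked n i j ≡ true → Linked n i j
linked⇒Linked n i j e with i <? j | i ≟ suc (suc j) | i ≟ j | 0 <? i | i <? n
linked⇒Linked n i j _  | yes p | _     | _     | _     | _     = asc p
linked⇒Linked n i j _  | no _  | yes p | _     | _     | _     = back p
linked⇒Linked n i j _  | no _  | no _  | yes p | yes q | yes r = diag p q r
linked⇒Linked n i j () | no _  | no _  | yes _ | yes _ | no _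
linked⇒Linked n i j () | no _  | no _  | yes _ | no _  | _
linked⇒Linked n i j () | no _  | no _  | no _  | _     | _

linked⇒Unlinked : ∀ n i j → linked n i j ≡ false → Unlinked n i j
linked⇒Unlinked n i j e with i <? j | i ≟ suc (suc j) | i ≟ j | 0 <? i | i <? n
linked⇒Unlinked n i j () | yes _ | _     | _     | _     | _
linked⇒Unlinked n i j () | no _  | yes _ | _     | _     | _
linked⇒Unlinked n i j () | no _  | no _  | yes _ | yes _ | yes _
linked⇒Unlinked n i j _  | no x  | no y  | yes _ | yes _ | no r = unlinked (≮⇒≥ x) y (λ _ → inj₂ (≮⇒≥ r))
linked⇒Unlinked n i j _  | no x  | no y  | yes _ | no q  | _    = unlinked (≮⇒≥ x) y (λ _ → inj₁ (n≤0⇒n≡0 (≮⇒≥ q)))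
linked⇒Unlinked n i j _  | no x  | no y  | no z  | _     | _    = unlinked (≮⇒≥ x) y (λ p → ⊥-elim (z p))

Linked⇒linked : ∀ n i j → Linked n i j → linked n i j ≡ true
Linked⇒linked n i j L with i <? j | i ≟ suc (suc j) | i ≟ j | 0 <? i | i <? n
... | yes _ | _     | _     | _     | _     = refl
... | no _  | yes _ | _     | _     | _     = refl
... | no _  | no _  | yes _ | yes _ | yes _ = refl
Linked⇒linked n i j (asc p)      | no x | _    | _    | _    | _    = ⊥-elim (x p)
Linked⇒linked n i j (back p)     | no _ | no y | _    | _    | _    = ⊥-elim (y p)
Linked⇒linked n i j (diag p _ _) | no _ | no _ | no z | _    | _    = ⊥-elim (z p)
Linked⇒linked n i j (diag _ q _) | no _ | no _ | yes _ | no w | _   = ⊥-elim (w q)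
Linked⇒linked n i j (diag _ _ r) | no _ | no _ | yes _ | yes _ | no w = ⊥-elim (w r)

Unlinked⇒linked : ∀ n i j → Unlinked n i j → linked n i j ≡ false
Unlinked⇒linked n i j U with i <? j | i ≟ suc (suc j) | i ≟ j | 0 <? i | i <? n
... | yes p | _     | _     | _     | _     = ⊥-elim (<⇒≱ p (col≤row U))
... | no _  | yes p | _     | _     | _     = ⊥-elim (not-back U p)
... | no _  | no _  | yes p | yes q | yes r with diag-end U p
...   | inj₁ refl = ⊥-elim (<-irrefl refl q)
...   | inj₂ n≤i = ⊥-elim (<⇒≱ r n≤i)
Unlinked⇒linked n i j U | no _ | no _ | yes _ | yes _ | no _ = refl
Unlinked⇒linked n i j U | no _ | no _ | yes _ | no _  | _    = refl
Unlinked⇒linked n i j U | no _ | no _ | no _  | _     | _    = refl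

between : ∀ {l i} → l ≤ i → i < suc (suc l) → i ≡ l ⊎ i ≡ suc l
between {zero}  {zero}        _       _               = inj₁ refl
between {zero}  {suc zero}    _       _               = inj₂ refl
between {zero}  {suc (suc i)} _       (s≤s (s≤s ()))
between {suc l} {suc i}       (s≤s p) (s≤s q) with between p q
... | inj₁ e = inj₁ (cong suc e)
... | inj₂ e = inj₂ (cong suc e)

between-above : ∀ {j l} → j < l → l ≤ suc (suc j) → l ≡ suc j ⊎ l ≡ suc (suc j)
between-above p q = between p (s≤s q)

no-room : ∀ {n x} → n ≤ suc (suc x) → suc (suc (suc (suc x))) ≤ n → ⊥
no-room p q = <-irrefl refl (≤-trans (s≤s (s≤s (n≤1+n _))) (≤-trans q p))

-- The following lemmas concern index pairs (i, j) and (k, l) forming a 2K₂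
-- of Γ n, i.e. x_i y_j and x_k y_l are edges while x_i y_l and x_k y_j are
-- not, or the analogous pattern for the bipartite complement.

-- The partner row of a non-back edge in row i.
partnerRow : ℕ → ℕ
partnerRow zero    = 2
partnerRow (suc m) = suc (suc m)

nonback-partner : ∀ {n i j k l} → j ≤ n → Linked n i j → Linked n k l → Unlinked n i l → Unlinked n k j →
                  i ≢ suc (suc j) → k ≡ suc (suc l) × k ≡ partnerRow i
nonback-partner j≤n (back p) _ _ _ nb = ⊥-elim (nb p)
nonback-partner j≤n (asc i<j) (asc k<l) U₁ U₂ _ =
  ⊥-elim (<-irrefl refl (<-≤-trans (<-trans (<-≤-trans i<j (col≤row U₂)) k<l) (col≤row U₁)))
nonback-partner j≤n (diag refl _ _) (asc k<l) U₁ U₂ _ =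
  ⊥-elim (<-irrefl refl (<-≤-trans k<l (≤-trans (col≤row U₁) (col≤row U₂))))
nonback-partner j≤n (asc i<j) (diag refl _ _) U₁ U₂ _ =
  ⊥-elim (<-irrefl refl (<-≤-trans i<j (≤-trans (col≤row U₂) (col≤row U₁))))
nonback-partner j≤n (diag refl _ _) (diag refl 0<k k<n) U₁ U₂ _
  with diag-end U₂ (≤-antisym (col≤row U₁) (col≤row U₂))
... | inj₁ e = ⊥-elim (<-irrefl refl (subst (0 <_) e 0<k))
... | inj₂ p = ⊥-elim (<⇒≱ k<n p)
nonback-partner j≤n (asc i<j) (back refl) U₁ U₂ _
  with between (col≤row U₁) (<-≤-trans i<j (col≤row U₂))
... | inj₂ refl = refl , refl
... | inj₁ refl with diag-end U₁ refl
...   | inj₁ refl = refl , refl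
...   | inj₂ n≤i = ⊥-elim (<-irrefl refl (<-≤-trans i<j (≤-trans j≤n n≤i)))
nonback-partner j≤n (diag refl 0<i i<n) (back refl) U₁ U₂ _
  with between (col≤row U₁) (≤∧≢⇒< (col≤row U₂) (not-back U₁))
... | inj₂ refl = refl , refl
... | inj₁ refl with diag-end U₁ refl
...   | inj₁ refl = ⊥-elim (<-irrefl refl 0<i)
...   | inj₂ n≤i = ⊥-elim (<⇒≱ i<n n≤i)

back-partners-consecutive : ∀ {n i j k l} → i ≤ n → k ≤ n → i ≡ suc (suc j) → k ≡ suc (suc l) →
                            Unlinked n i l → Unlinked n k j → k ≡ suc i ⊎ i ≡ suc k
back-partners-consecutive i≤n k≤n refl refl U₁ U₂ with <-cmp _ _
... | tri≈ _ e _ = ⊥-elim (not-back U₁ (cong (λ x → suc (suc x)) e))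
... | tri< j<l _ _ with between-above j<l (col≤row U₁)
...   | inj₁ refl = inj₁ refl
...   | inj₂ refl with diag-end U₁ refl
...     | inj₁ ()
...     | inj₂ p = ⊥-elim (no-room p k≤n)
back-partners-consecutive i≤n k≤n refl refl U₁ U₂ | tri> _ _ l<j with between-above l<j (col≤row U₂)
...   | inj₁ refl = inj₂ refl
...   | inj₂ refl with diag-end U₂ refl
...     | inj₁ ()
...     | inj₂ p = ⊥-elim (no-room p i≤n)

middle-back-partner : ∀ {n i j k l} → i < n → 3 ≤ i → i ≡ suc (suc j) → Linked n k l → k ≢ suc (suc l) →
                      Unlinked n i l → Unlinked n k j → l ≡ k
middle-back-partner i<n 3≤i _ (back p) nb U₁ U₂ = ⊥-elim (nb p)
middle-back-partner i<n 3≤i _ (diag p _ _) nb U₁ U₂ = sym p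
middle-back-partner i<n 3≤i refl (asc k<l) nb U₁ U₂
  with between (col≤row U₂) (<-≤-trans k<l (col≤row U₁))
... | inj₂ refl with ≤-antisym (col≤row U₁) k<l
...   | refl with diag-end U₁ refl
...     | inj₁ ()
...     | inj₂ p = ⊥-elim (<⇒≱ i<n p)
middle-back-partner i<n 3≤i refl (asc k<l) nb U₁ U₂ | inj₁ refl with diag-end U₂ refl
...   | inj₁ refl = ⊥-elim (<-irrefl refl (≤-trans 3≤i (s≤s (s≤s z≤n))))
...   | inj₂ p = ⊥-elim (<-irrefl refl (<-≤-trans (<-≤-trans k<l (col≤row U₁)) (≤-trans (<⇒≤ i<n) p)))

-- The co-partner row of a non-edge (i, j) of the complement with i ≠ j + 1.
copartnerRow : ℕ → ℕ
copartnerRow zero          = 2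
copartnerRow (suc zero)    = 2
copartnerRow (suc (suc m)) = suc m

CopartnerClaim : ℕ → ℕ → ℕ → ℕ → ℕ → Set
CopartnerClaim n i j k l =
  Unlinked n i j → Unlinked n k l → Linked n k j → i ≢ suc j → k ≡ suc l × k ≡ copartnerRow i

copartner-asc : ∀ {n i j k l} → 3 ≤ n → k ≤ n → i < l → CopartnerClaim n i j k l
copartner-asc 3≤n k≤n i<l U₁ U₂ (asc k<j) _ =
  ⊥-elim (<-irrefl refl (<-≤-trans (<-≤-trans k<j (col≤row U₁)) (≤-trans (<⇒≤ i<l) (col≤row U₂))))
copartner-asc 3≤n k≤n i<l U₁ U₂ (diag refl _ _) _ =
  ⊥-elim (<-irrefl refl (<-≤-trans i<l (≤-trans (col≤row U₂) (col≤row U₁))))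
copartner-asc 3≤n k≤n i<l U₁ U₂ (back refl) ns
  with between (col≤row U₁) (<-≤-trans i<l (col≤row U₂))
... | inj₂ e = ⊥-elim (ns e)
... | inj₁ refl with diag-end U₁ refl
...   | inj₂ n≤i = ⊥-elim (<-irrefl refl (<-≤-trans i<l (≤-trans (col≤row U₂) (≤-trans k≤n n≤i))))
...   | inj₁ refl with between-above i<l (col≤row U₂)
...     | inj₁ refl = refl , refl
...     | inj₂ refl with diag-end U₂ refl
...       | inj₁ ()
...       | inj₂ p = ⊥-elim (<-irrefl refl (≤-trans 3≤n p))

copartner-back : ∀ {n i j k l} → 3 ≤ n → i ≤ n → j ≤ n → k ≤ n → i ≡ suc (suc l) → CopartnerClaim n i j k l
copartner-back 3≤n i≤n j≤n k≤n refl U₁ U₂ (asc k<j) ns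
  with between (col≤row U₂) (<-≤-trans k<j (col≤row U₁))
... | inj₂ refl = refl , refl
... | inj₁ refl with diag-end U₂ refl
...   | inj₂ n≤k = ⊥-elim (<-irrefl refl (<-≤-trans k<j (≤-trans j≤n n≤k)))
...   | inj₁ refl with between-above k<j (col≤row U₁)
...     | inj₁ refl = ⊥-elim (ns refl)
...     | inj₂ refl with diag-end U₁ refl
...       | inj₁ ()
...       | inj₂ p = ⊥-elim (<-irrefl refl (≤-trans 3≤n p))
copartner-back 3≤n i≤n j≤n k≤n refl U₁ U₂ (back refl) ns with <-cmp _ _
... | tri≈ _ e _ = ⊥-elim (not-back U₂ (cong (λ x → suc (suc x)) e))
... | tri< j<l _ _ with between-above j<l (col≤row U₂)
...   | inj₁ refl = refl , refl
...   | inj₂ refl with diag-end U₂ refl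
...     | inj₁ ()
...     | inj₂ p = ⊥-elim (no-room p i≤n)
copartner-back 3≤n i≤n j≤n k≤n refl U₁ U₂ (back refl) ns | tri> _ _ l<j
  with between-above l<j (col≤row U₁)
...   | inj₁ refl = ⊥-elim (ns refl)
...   | inj₂ refl with diag-end U₁ refl
...     | inj₁ ()
...     | inj₂ p = ⊥-elim (no-room p k≤n)
copartner-back 3≤n i≤n j≤n k≤n refl U₁ U₂ (diag refl _ _) ns
  with between (col≤row U₂) (≤∧≢⇒< (col≤row U₁) (not-back U₂))
... | inj₁ e = ⊥-elim (not-back U₁ (cong (λ x → suc (suc x)) (sym e)))
... | inj₂ e = ⊥-elim (ns (cong suc (sym e)))

copartner-diag : ∀ {n i j k l} → i ≡ l → 0 < i → i < n → CopartnerClaim n i j k l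
copartner-diag refl 0<i i<n U₁ U₂ (asc k<j) _ =
  ⊥-elim (<-irrefl refl (<-≤-trans k<j (≤-trans (col≤row U₁) (col≤row U₂))))
copartner-diag refl 0<i i<n U₁ U₂ (diag refl _ _) _
  with diag-end U₁ (≤-antisym (col≤row U₂) (col≤row U₁))
... | inj₁ refl = ⊥-elim (<-irrefl refl 0<i)
... | inj₂ p = ⊥-elim (<⇒≱ i<n p)
copartner-diag {n} {i} {j} refl 0<i i<n U₁ U₂ (back refl) ns
  with between (col≤row U₁) (≤∧≢⇒< (col≤row U₂) i≢2+j)
  where
  i≢2+j : i ≢ suc (suc j)
  i≢2+j e with diag-end U₂ (sym e)
  ... | inj₂ p = <⇒≱ i<n (subst (n ≤_) (sym e) p)
... | inj₂ e = ⊥-elim (ns e)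
... | inj₁ refl with diag-end U₁ refl
...   | inj₁ refl = ⊥-elim (<-irrefl refl 0<i)
...   | inj₂ p = ⊥-elim (<⇒≱ i<n p)

nonsucc-copartner : ∀ {n i j k l} → 3 ≤ n → i ≤ n → j ≤ n → k ≤ n → Linked n i l → CopartnerClaim n i j k l
nonsucc-copartner 3≤n i≤n j≤n k≤n (asc i<l)        = copartner-asc 3≤n k≤n i<l
nonsucc-copartner 3≤n i≤n j≤n k≤n (back e)         = copartner-back 3≤n i≤n j≤n k≤n e
nonsucc-copartner 3≤n i≤n j≤n k≤n (diag e 0<i i<n) = copartner-diag e 0<i i<n

even : ℕ → Bool
even zero          = true
even (suc zero)    = false
even (suc (suc k)) = even k

even-suc : ∀ k → even (suc k) ≡ not (even k)
even-suc zero          = refl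
even-suc (suc zero)    = refl
even-suc (suc (suc k)) = even-suc k

parity-alternates : ∀ k → even (suc k) ≢ even k
parity-alternates k e = not-¬ refl (sym (trans (sym (even-suc k)) e))

odd-positive : ∀ i → even i ≡ false → 0 < i
odd-positive (suc _) _ = s≤s z≤n

module Ranks (n : ℕ) where

  -- Y: even indices ascending, then odd indices descending.
  ρY : ℕ → ℕ
  ρY j = if even j then j else suc (n + n) ∸ j

  -- X: odd indices descending, then even indices ascending.
  ρX : ℕ → ℕ
  ρX i = if even i then suc n + i else suc n ∸ i

  ≤-double : ∀ {j} → j ≤ n → j ≤ suc (n + n)
  ≤-double j≤n = ≤-trans j≤n (≤-trans (m≤m+n n n) (n≤1+n _))

  n<oddRankY : ∀ {j} → j ≤ n → n < suc (n + n) ∸ j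
  n<oddRankY j≤n = ≤-trans (≤-reflexive (sym (m+n∸n≡m (suc n) n))) (∸-monoʳ-≤ (suc (n + n)) j≤n)

  n<evenRankX : ∀ i → n < suc n + i
  n<evenRankX i = s≤s (m≤m+n n i)

  oddRankX≤n : ∀ {i} → 0 < i → suc n ∸ i ≤ n
  oddRankX≤n = ∸-monoʳ-≤ (suc n)

  nearY : ∀ {j₀ j} → j₀ < j ⊎ j₀ ≡ suc j → j₀ ≤ n → j ≤ n → Beyond (even j₀) (ρY j₀) (ρY j)
  nearY {j₀} {j} near j₀≤n j≤n with even j₀ in e₀ | even j in e
  nearY (inj₁ lt) _ _ | true | true = lt
  nearY {j = j} (inj₂ refl) _ _ | true | true = ⊥-elim (parity-alternates j (trans e₀ (sym e)))
  nearY _ j₀≤n j≤n | true  | false = ≤-<-trans j₀≤n (n<oddRankY j≤n)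
  nearY _ j₀≤n j≤n | false | true  = ≤-<-trans j≤n (n<oddRankY j₀≤n)
  nearY (inj₁ lt) _ j≤n | false | false = ∸-monoʳ-< lt (≤-double j≤n)
  nearY {j = j} (inj₂ refl) _ _ | false | false = ⊥-elim (parity-alternates j (trans e₀ (sym e)))

  backY : ∀ j → suc (suc j) ≤ n → Beyond (not (even j)) (ρY (suc (suc j))) (ρY j)
  backY j 2+j≤n with even j in e
  ... | true = n≤1+n _
  ... | false = ∸-monoʳ-< (n≤1+n (suc j)) (≤-double 2+j≤n)

  nearX : ∀ {i₀ i} → i < i₀ ⊎ i ≡ suc i₀ → i₀ ≤ n → i ≤ n → Beyond (not (even i₀)) (ρX i₀) (ρX i)
  nearX {i₀} {i} near i₀≤n i≤n with even i₀ in e₀ | even i in e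
  nearX {i₀} {i} (inj₁ lt) _ _ | true | true = +-monoʳ-< (suc n) lt
  nearX {i₀} (inj₂ refl) _ _ | true | true = ⊥-elim (parity-alternates i₀ (trans e (sym e₀)))
  nearX {i₀} {i} _ _ _ | true  | false = ≤-<-trans (oddRankX≤n (odd-positive i e)) (n<evenRankX i₀)
  nearX {i₀} {i} _ _ _ | false | true  = ≤-<-trans (oddRankX≤n (odd-positive i₀ e₀)) (n<evenRankX i)
  nearX (inj₁ lt) i₀≤n _ | false | false = ∸-monoʳ-< lt (≤-trans i₀≤n (n≤1+n _))
  nearX {i₀} (inj₂ refl) _ _ | false | false = ⊥-elim (parity-alternates i₀ (trans e (sym e₀)))

  ρY-injective : ∀ {j j'} → j ≤ n → j' ≤ n → ρY j ≡ ρY j' → j ≡ j'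
  ρY-injective {j} {j'} j≤n j'≤n eq with even j | even j'
  ... | true  | true  = eq
  ... | false | false = ∸-cancelˡ-≡ (≤-double j≤n) (≤-double j'≤n) eq
  ... | true  | false = ⊥-elim (<⇒≢ (≤-<-trans j≤n (n<oddRankY j'≤n)) eq)
  ... | false | true  = ⊥-elim (<⇒≢ (≤-<-trans j'≤n (n<oddRankY j≤n)) (sym eq))

  ρX-injective : ∀ {i i'} → i ≤ n → i' ≤ n → ρX i ≡ ρX i' → i ≡ i'
  ρX-injective {i} {i'} i≤n i'≤n eq with even i in e | even i' in e'
  ... | true  | true  = +-cancelˡ-≡ (suc n) _ _ eq
  ... | false | false = ∸-cancelˡ-≡ (≤-trans i≤n (n≤1+n _)) (≤-trans i'≤n (n≤1+n _)) eq
  ... | true  | false = ⊥-elim (<⇒≢ (≤-<-trans (oddRankX≤n (odd-positive i' e')) (n<evenRankX i)) (sym eq))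
  ... | false | true  = ⊥-elim (<⇒≢ (≤-<-trans (oddRankX≤n (odd-positive i e)) (n<evenRankX i')) eq)

  separatedY : ∀ {i j₀} → j₀ ≤ n → Unlinked n i j₀ → Separated ρY (λ j → j ≤ n × Linked n i j) j₀
  separatedY {i} {j₀} j₀≤n U with m≤n⇒m<n∨m≡n (col≤row U)
  ... | inj₁ j₀<i = beyond-separated ρY (even j₀) λ { j (j≤n , L) → nearY (near L) j₀≤n j≤n }
    where
    near : ∀ {j} → Linked n i j → j₀ < j ⊎ j₀ ≡ suc j
    near (asc i<j)       = inj₁ (<-trans j₀<i i<j)
    near (diag refl _ _) = inj₁ j₀<i
    near (back refl) with m≤n⇒m<n∨m≡n (≤-pred j₀<i)
    ... | inj₂ j₀≡1+j = inj₂ j₀≡1+j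
    ... | inj₁ j₀<1+j with m≤n⇒m<n∨m≡n (≤-pred j₀<1+j)
    ...   | inj₁ j₀<j = inj₁ j₀<j
    ...   | inj₂ refl = ⊥-elim (not-back U refl)
  ... | inj₂ refl with diag-end U refl
  ...   | inj₁ refl = beyond-separated ρY true λ { j (j≤n , L) → nearY (inj₁ (above-0 L)) z≤n j≤n }
    where
    above-0 : ∀ {j} → Linked n 0 j → 0 < j
    above-0 (asc 0<j) = 0<j
    above-0 (diag _ () _)
  ...   | inj₂ n≤i = beyond-separated ρY (not (even i)) λ { j (j≤n , L) → only-back j j≤n L }
    where
    only-back : ∀ j → j ≤ n → Linked n i j → Beyond (not (even i)) (ρY i) (ρY j)
    only-back j j≤n (asc i<j)      = ⊥-elim (<⇒≱ (<-≤-trans i<j j≤n) n≤i)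
    only-back j j≤n (diag _ _ i<n) = ⊥-elim (<⇒≱ i<n n≤i)
    only-back j j≤n (back refl)    = backY j j₀≤n

  separatedX : ∀ {i₀ j} → i₀ ≤ n → Unlinked n i₀ j → Separated ρX (λ i → i ≤ n × Linked n i j) i₀
  separatedX {i₀} {j} i₀≤n U with m≤n⇒m<n∨m≡n (col≤row U)
  ... | inj₁ j<i₀ = beyond-separated ρX (not (even i₀)) λ { i (i≤n , L) → nearX (near L) i₀≤n i≤n }
    where
    near : ∀ {i} → Linked n i j → i < i₀ ⊎ i ≡ suc i₀
    near (asc i<j)       = inj₁ (<-trans i<j j<i₀)
    near (diag refl _ _) = inj₁ j<i₀
    near (back refl) with m≤n⇒m<n∨m≡n j<i₀
    ... | inj₂ refl = inj₂ refl
    ... | inj₁ 1+j<i₀ = inj₁ (≤∧≢⇒< 1+j<i₀ (λ e → not-back U (sym e)))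
  ... | inj₂ refl with diag-end U refl
  ...   | inj₁ refl = beyond-separated ρX true λ { i (_ , L) → above-0 L }
    where
    above-0 : ∀ {i} → Linked n i 0 → ρX 0 < ρX i
    above-0 (back refl)   = +-monoʳ-< (suc n) (s≤s z≤n)
    above-0 (diag refl () _)
  ...   | inj₂ n≤i₀ = beyond-separated ρX (not (even i₀)) λ { i (i≤n , L) → nearX (inj₁ (below L i≤n)) i₀≤n i≤n }
    where
    below : ∀ {i} → Linked n i i₀ → i ≤ n → i < i₀
    below (asc i<i₀)     _   = i<i₀
    below (back refl)    i≤n = ⊥-elim (<⇒≱ (<-≤-trans (s≤s (n≤1+n i₀)) i≤n) n≤i₀)
    below (diag refl _ i<n) _ = ⊥-elim (<⇒≱ i<n n≤i₀)

linkedFin : (n : ℕ) → Fin (suc n) → Fin (suc n) → Bool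
linkedFin n i j = linked n (toℕ i) (toℕ j)

Γ : ℕ → Graph
Γ n = Bipartite.graph (linkedFin n)

module Γ-Structure (n : ℕ) where
  open Bipartite (linkedFin n) public

  bound : (i : Fin (suc n)) → toℕ i ≤ n
  bound i = ≤-pred (toℕ<n i)

  I J : ∀ {u v} → Crossing u v → ℕ
  I o = toℕ (row o)
  J o = toℕ (col o)

  edge-Linked : ∀ {u v} → A u v ≡ true → (o : Crossing u v) → Linked n (I o) (J o)
  edge-Linked e o = linked⇒Linked n _ _ (trans (sym (crossing-adj o)) e)

  nonedge-Unlinked : ∀ {u v} → A u v ≡ false → (o : Crossing u v) → Unlinked n (I o) (J o)
  nonedge-Unlinked e o = linked⇒Unlinked n _ _ (trans (sym (crossing-adj o)) e)

  2K2-Unlinked : ∀ {u v w z} → Induced2K2 (Γ n) u v w z → (o₁ : Crossing u v) (o₂ : Crossing w z) →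
                 Unlinked n (I o₁) (J o₂) × Unlinked n (I o₂) (J o₁)
  2K2-Unlinked q o₁ o₂ with 2K2-nonlinks q o₁ o₂
  ... | f₁₂ , f₂₁ = linked⇒Unlinked n _ _ f₁₂ , linked⇒Unlinked n _ _ f₂₁

  co2K2-Linked : ∀ {u v w z} → InducedCo2K2 (Γ n) side u v w z → (o₁ : Crossing u v) (o₂ : Crossing w z) →
                 Linked n (I o₁) (J o₂) × Linked n (I o₂) (J o₁)
  co2K2-Linked q o₁ o₂ with co2K2-links q o₁ o₂
  ... | t₁₂ , t₂₁ = linked⇒Linked n _ _ t₁₂ , linked⇒Linked n _ _ t₂₁

  IsBack IsSucc IsDiag : ℕ → ℕ → Set
  IsBack i j = i ≡ suc (suc j)
  IsSucc i j = i ≡ suc j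
  IsDiag i j = j ≡ i

  BackEdge SuccPair DiagPair : V → V → Set
  BackEdge = Marked IsBack
  SuccPair = Marked IsSucc
  DiagPair = Marked IsDiag

  module BackMatching = Matching {IsBack} (λ e e' → suc-injective (suc-injective (trans (sym e) e'))) (λ e e' → trans e (sym e'))
  module SuccMatching = Matching {IsSucc} (λ e e' → suc-injective (trans (sym e) e')) (λ e e' → trans e (sym e'))
  module DiagMatching = Matching {IsDiag} (λ e e' → trans e (sym e')) (λ e e' → trans (sym e) e')

  unique-partner : ∀ {u v w z w' z'} → Induced2K2 (Γ n) u v w z → Induced2K2 (Γ n) u v w' z' →
                   BackEdge u v ⊎ SamePair w z w' z'
  unique-partner {u} {v} {w} {z} {w'} {z'} q q' with orient-edge u v (edge₁ q)
  ... | o with I o ≟ suc (suc (J o))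
  ...   | yes isBack = inj₁ (o , isBack)
  ...   | no nonback = inj₂ (crossing-samePair o₂ o₃ (toℕ-injective same-row) (toℕ-injective same-col))
    where
    o₂ : Crossing w z
    o₂ = orient-edge w z (edge₂ q)
    o₃ : Crossing w' z'
    o₃ = orient-edge w' z' (edge₂ q')
    partner : ∀ {w z} → Induced2K2 (Γ n) u v w z → (o' : Crossing w z) →
              I o' ≡ suc (suc (J o')) × I o' ≡ partnerRow (I o)
    partner p o' with 2K2-Unlinked p o o'
    ... | U₁ , U₂ = nonback-partner (bound (col o)) (edge-Linked (edge₁ p) o) (edge-Linked (edge₂ p) o') U₁ U₂ nonback
    same-row : I o₂ ≡ I o₃
    same-row = trans (proj₂ (partner q o₂)) (sym (proj₂ (partner q' o₃)))
    same-col : J o₂ ≡ J o₃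
    same-col = suc-injective (suc-injective (trans (sym (proj₁ (partner q o₂))) (trans same-row (proj₁ (partner q' o₃)))))

  consecutive-back : ∀ {u v w z} → Induced2K2 (Γ n) u v w z → ((o₁ , _) : BackEdge u v) ((o₂ , _) : BackEdge w z) →
                     I o₂ ≡ suc (I o₁) ⊎ I o₁ ≡ suc (I o₂)
  consecutive-back q (o₁ , b₁) (o₂ , b₂) with 2K2-Unlinked q o₁ o₂
  ... | U₁ , U₂ = back-partners-consecutive (bound (row o₁)) (bound (row o₂)) b₁ b₂ U₁ U₂

  middle-partner-kind : ∀ {u v w z} ((o , _) : BackEdge u v) → 3 ≤ I o → I o < n →
                        Induced2K2 (Γ n) u v w z → DiagPair w z ⊎ BackEdge w z
  middle-partner-kind {w = w} {z} (o , b) 3≤i i<n q with orient-edge w z (edge₂ q)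
  ... | o' with I o' ≟ suc (suc (J o'))
  ...   | yes isBack = inj₂ (o' , isBack)
  ...   | no nonback with 2K2-Unlinked q o o'
  ...     | U₁ , U₂ = inj₁ (o' , middle-back-partner i<n 3≤i b (edge-Linked (edge₂ q) o') nonback U₁ U₂)

  -- A back edge in a middle row has no three pairwise different 2K₂-partners
  -- through a common vertex c: two of them would have the same kind, and pairs
  -- of one kind sharing a vertex coincide.
  no-three-partners : ∀ {u v w₁ z₁ w₂ z₂ w₃ z₃ c} (b : BackEdge u v) → 3 ≤ I (proj₁ b) → I (proj₁ b) < n →
    Induced2K2 (Γ n) u v w₁ z₁ → Induced2K2 (Γ n) u v w₂ z₂ → Induced2K2 (Γ n) u v w₃ z₃ →
    ¬ SamePair w₁ z₁ w₂ z₂ → ¬ SamePair w₁ z₁ w₃ z₃ → ¬ SamePair w₂ z₂ w₃ z₃ →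
    c ≡ w₁ ⊎ c ≡ z₁ → c ≡ w₂ ⊎ c ≡ z₂ → c ≡ w₃ ⊎ c ≡ z₃ → ⊥
  no-three-partners b 3≤i i<n q₁ q₂ q₃ d₁₂ d₁₃ d₂₃ c₁ c₂ c₃
    with middle-partner-kind b 3≤i i<n q₁ | middle-partner-kind b 3≤i i<n q₂ | middle-partner-kind b 3≤i i<n q₃
  ... | inj₁ k₁ | inj₁ k₂ | _       = d₁₂ (DiagMatching.marked-shared k₁ k₂ c₁ c₂)
  ... | inj₁ k₁ | _       | inj₁ k₃ = d₁₃ (DiagMatching.marked-shared k₁ k₃ c₁ c₃)
  ... | _       | inj₁ k₂ | inj₁ k₃ = d₂₃ (DiagMatching.marked-shared k₂ k₃ c₂ c₃)
  ... | inj₂ k₁ | inj₂ k₂ | _       = d₁₂ (BackMatching.marked-shared k₁ k₂ c₁ c₂)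
  ... | inj₂ k₁ | _       | inj₂ k₃ = d₁₃ (BackMatching.marked-shared k₁ k₃ c₁ c₃)
  ... | _       | inj₂ k₂ | inj₂ k₃ = d₂₃ (BackMatching.marked-shared k₂ k₃ c₂ c₃)

  back-row-range : ∀ {u v} ((o , _) : BackEdge u v) → ¬ (3 ≤ I o × I o < n) → I o ≡ 2 ⊎ I o ≡ n
  back-row-range (o , isBack) not-middle with 3 ≤? I o | I o <? n
  ... | yes 3≤i | yes i<n = ⊥-elim (not-middle (3≤i , i<n))
  ... | no 3≰i  | _       = inj₁ (≤-antisym (≤-pred (≰⇒> 3≰i)) (subst (2 ≤_) (sym isBack) (s≤s (s≤s z≤n))))
  ... | yes _   | no i≮n  = inj₂ (≤-antisym (bound (row o)) (≮⇒≥ i≮n))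

  unique-copartner : 3 ≤ n → ∀ {u v w z w' z'} → InducedCo2K2 (Γ n) side u v w z → InducedCo2K2 (Γ n) side u v w' z' →
                     SuccPair u v ⊎ SamePair w z w' z'
  unique-copartner 3≤n {u} {v} {w} {z} {w'} {z'} q q' with orient u v (opposite q)
  ... | o with I o ≟ suc (J o)
  ...   | yes isSucc = inj₁ (o , isSucc)
  ...   | no nonsucc = inj₂ (crossing-samePair o₂ o₃ (toℕ-injective same-row) (toℕ-injective same-col))
    where
    o₂ : Crossing w z
    o₂ = orient w z (co2K2-crossing q)
    o₃ : Crossing w' z'
    o₃ = orient w' z' (co2K2-crossing q')
    copartner : ∀ {w z} → InducedCo2K2 (Γ n) side u v w z → (o' : Crossing w z) →
                I o' ≡ suc (J o') × I o' ≡ copartnerRow (I o)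
    copartner p o' with co2K2-Linked p o o'
    ... | L₁ , L₂ = nonsucc-copartner 3≤n (bound (row o)) (bound (col o)) (bound (row o'))
                      L₁ (nonedge-Unlinked (nonEdge₁ p) o) (nonedge-Unlinked (nonEdge₂ p) o') L₂ nonsucc
    same-row : I o₂ ≡ I o₃
    same-row = trans (proj₂ (copartner q o₂)) (sym (proj₂ (copartner q' o₃)))
    same-col : J o₂ ≡ J o₃
    same-col = suc-injective (trans (sym (proj₁ (copartner q o₂))) (trans same-row (proj₁ (copartner q' o₃))))

Γ-P8-free : ∀ n → ¬ (P 8 ≤ᵢ Γ n)
Γ-P8-free n = P8-free-criterion (Γ n) BackEdge unique-partner (marked-swap {IsBack}) BackMatching.marked-functional
  where open Γ-Structure n

Γ-P̃8-free : ∀ n → 3 ≤ n → ¬ (P̃8 ≤ᵢ Γ n)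
Γ-P̃8-free n 3≤n = P̃8-free-criterion (Γ n) side edges-cross SuccPair (unique-copartner 3≤n) (marked-swap {IsSucc}) SuccMatching.marked-functional
  where open Γ-Structure n

Γ-biconvex : ∀ n → Biconvex (Γ n)
Γ-biconvex n = biconvex-criterion (λ i → ρX (toℕ i)) (λ j → ρY (toℕ j))
  (λ {i} {i'} e → toℕ-injective (ρX-injective (bound i) (bound i') e))
  (λ {j} {j'} e → toℕ-injective (ρY-injective (bound j) (bound j') e))
  (λ i j₀ e → restrict-Y i (separatedY (bound j₀) (linked⇒Unlinked n _ _ e)))
  (λ i₀ j e → restrict-X j (separatedX (bound i₀) (linked⇒Unlinked n _ _ e)))
  where
  open Γ-Structure n
  open Ranks n
  restrict-Y : ∀ i {j₀} → Separated ρY (λ j → j ≤ n × Linked n (toℕ i) j) (toℕ j₀) →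
               Separated (λ j → ρY (toℕ j)) (λ j → linkedFin n i j ≡ true) j₀
  restrict-Y i (all-below below) = all-below λ j e → below (toℕ j) (bound j , linked⇒Linked n _ _ e)
  restrict-Y i (all-above above) = all-above λ j e → above (toℕ j) (bound j , linked⇒Linked n _ _ e)
  restrict-X : ∀ j {i₀} → Separated ρX (λ i → i ≤ n × Linked n i (toℕ j)) (toℕ i₀) →
               Separated (λ i → ρX (toℕ i)) (λ i → linkedFin n i j ≡ true) i₀
  restrict-X j (all-below below) = all-below λ i e → below (toℕ i) (bound i , linked⇒Linked n _ _ e)
  restrict-X j (all-above above) = all-above λ i e → above (toℕ i) (bound i , linked⇒Linked n _ _ e)

-- Write a = c + 3.  The back edges e_t = x_{t+2} y_t (t = 0, …, c + 1) of
-- Γ a form a chain in which consecutive edges induce 2K₂'s.  Each e_t has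
-- two different 2K₂-partners, so its image is a back edge of Γ b, in some row
-- r_t; consecutive rows differ by one, so |r_t - r_0| ≤ t.  The end edges
-- e_0 and e_{c+1} have three different partners through a common vertex,
-- so r_0 and r_{c+1} are end rows 2 or b; being different, |r_{c+1} - r_0|
-- = b - 2 > c + 1, a contradiction.
module NoEmbedding (c b : ℕ) (a<b : suc (suc (suc c)) < b) (emb : Γ (suc (suc (suc c))) ≤ᵢ Γ b) where
  a : ℕ
  a = suc (suc (suc c))

  module Src = Γ-Structure a
  module Tgt = Γ-Structure b

  φ : Src.V → Tgt.V
  φ = proj₁ emb

  φ-injective : ∀ u v → φ u ≡ φ v → u ≡ v
  φ-injective = proj₁ (proj₂ emb)

  image : ∀ {u v w z} → Induced2K2 (Γ a) u v w z → Induced2K2 (Γ b) (φ u) (φ v) (φ w) (φ z)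
  image = 2K2-image emb

  -- Vertices of Γ a addressed by natural-number indices.  Only toℕ-fin is needed
  -- about fin, so it is kept abstract.
  abstract
    fin : ℕ → Fin (suc a)
    fin t with t ≤? a
    ... | yes t≤a = fromℕ< (s≤s t≤a)
    ... | no _    = Fin.zero

    toℕ-fin : ∀ {t} → t ≤ a → toℕ (fin t) ≡ t
    toℕ-fin {t} t≤a with t ≤? a
    ... | yes t≤a' = toℕ-fromℕ< (s≤s t≤a')
    ... | no t≰a   = ⊥-elim (t≰a t≤a)

  x y : ℕ → Src.V
  x t = Src.X (fin t)
  y t = Src.Y (fin t)

  adj-xy : ∀ {s t} → s ≤ a → t ≤ a → Src.A (x s) (y t) ≡ linked a s t
  adj-xy {s} {t} s≤a t≤a = trans (Src.adj-XY (fin s) (fin t)) (cong₂ (linked a) (toℕ-fin s≤a) (toℕ-fin t≤a))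

  x-injective : ∀ {s s'} → s ≤ a → s' ≤ a → x s ≡ x s' → s ≡ s'
  x-injective s≤a s'≤a e = trans (sym (toℕ-fin s≤a)) (trans (cong toℕ (Src.X-injective e)) (toℕ-fin s'≤a))

  y-injective : ∀ {t t'} → t ≤ a → t' ≤ a → y t ≡ y t' → t ≡ t'
  y-injective t≤a t'≤a e = trans (sym (toℕ-fin t≤a)) (trans (cong toℕ (Src.Y-injective e)) (toℕ-fin t'≤a))

  different-rows : ∀ {s s' t t'} → s ≤ a → s' ≤ a → s ≢ s' → ¬ SamePair (φ (x s)) (φ (y t)) (φ (x s')) (φ (y t'))
  different-rows s≤a s'≤a s≢s' (inj₁ (e , _)) = s≢s' (x-injective s≤a s'≤a (φ-injective _ _ e))
  different-rows _ _ _ (inj₂ (e , _)) = Src.X≢Y _ _ (φ-injective _ _ e)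

  different-cols : ∀ {s s' t t'} → t ≤ a → t' ≤ a → t ≢ t' → ¬ SamePair (φ (x s)) (φ (y t)) (φ (x s')) (φ (y t'))
  different-cols t≤a t'≤a t≢t' (inj₁ (_ , e)) = t≢t' (y-injective t≤a t'≤a (φ-injective _ _ e))
  different-cols _ _ _ (inj₂ (e , _)) = Src.X≢Y _ _ (φ-injective _ _ e)

  index2K2 : ∀ {s t s' t'} → s ≤ a → t ≤ a → s' ≤ a → t' ≤ a →
             Linked a s t → Linked a s' t' → Unlinked a s t' → Unlinked a s' t →
             Induced2K2 (Γ a) (x s) (y t) (x s') (y t')
  index2K2 {s} {t} {s'} {t'} s≤a t≤a s'≤a t'≤a L₁ L₂ U₁ U₂ =
    induced2K2 (trans (adj-xy s≤a t≤a) (Linked⇒linked a s t L₁))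
               (trans (adj-xy s'≤a t'≤a) (Linked⇒linked a s' t' L₂))
               (Src.adj-XX (fin s) (fin s'))
               (trans (adj-xy s≤a t'≤a) (Unlinked⇒linked a s t' U₁))
               (trans (Graph.sym (Γ a) (y t) (x s')) (trans (adj-xy s'≤a t≤a) (Unlinked⇒linked a s' t U₂)))
               (Src.adj-YY (fin t) (fin t'))

  unlinked-1 : ∀ t → Unlinked a (suc t) t
  unlinked-1 t = unlinked (n≤1+n t) (λ e → m≢1+n+m t {0} (suc-injective e)) (λ e → ⊥-elim (m≢1+n+m t {0} (sym e)))

  unlinked-3 : ∀ t → Unlinked a (suc (suc (suc t))) t
  unlinked-3 t = unlinked (≤-trans (n≤1+n t) (≤-trans (n≤1+n _) (n≤1+n _)))
                          (λ e → m≢1+n+m t {0} (sym (suc-injective (suc-injective e))))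
                          (λ e → ⊥-elim (m≢1+n+m t {2} (sym e)))

  ≤-down : ∀ {s t} → suc s ≤ t → s ≤ t
  ≤-down = <⇒≤

  diag-partner : ∀ t → suc (suc t) ≤ a → Induced2K2 (Γ a) (x (suc (suc t))) (y t) (x (suc t)) (y (suc t))
  diag-partner t p = index2K2 p (≤-down (≤-down p)) (≤-down p) (≤-down p)
                       (back refl) (diag refl (s≤s z≤n) p) (unlinked-1 (suc t)) (unlinked-1 t)

  next-partner : ∀ t → suc (suc (suc t)) ≤ a →
                 Induced2K2 (Γ a) (x (suc (suc t))) (y t) (x (suc (suc (suc t)))) (y (suc t))
  next-partner t p = index2K2 (≤-down p) (≤-down (≤-down (≤-down p))) p (≤-down (≤-down p))
                       (back refl) (back refl) (unlinked-1 (suc t)) (unlinked-3 t)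

  last-partner : ∀ t → suc (suc t) ≡ a →
                 Induced2K2 (Γ a) (x (suc (suc t))) (y t) (x (suc t)) (y (suc (suc t)))
  last-partner t refl = index2K2 ≤-refl (≤-down (≤-down ≤-refl)) (≤-down ≤-refl) ≤-refl
                          (back refl) (asc ≤-refl)
                          (unlinked ≤-refl (λ e → m≢1+n+m t {1} (suc-injective (suc-injective e))) (λ _ → inj₂ ≤-refl))
                          (unlinked-1 t)

  -- The image of every back edge e_t is a back edge of Γ b: e_t has two
  -- different 2K₂-partners (its diagonal partner and the next back edge, or
  -- the ascending edge x_{t+1} y_{t+2} at the end of the chain).  Only the
  -- existence matters, so the proof is kept abstract.
  abstract
    image-back : ∀ t → suc (suc t) ≤ a → Tgt.BackEdge (φ (x (suc (suc t)))) (φ (y t))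
    image-back t p with m≤n⇒m<n∨m≡n p
    ... | inj₁ 3+t≤a with Tgt.unique-partner (image (diag-partner t p)) (image (next-partner t 3+t≤a))
    ...   | inj₁ isBack = isBack
    ...   | inj₂ same = ⊥-elim (different-rows {suc t} {suc (suc (suc t))} {suc t} {suc t} (≤-down p) 3+t≤a (m≢1+n+m (suc t) {1}) same)
    image-back t p | inj₂ 2+t≡a with Tgt.unique-partner (image (diag-partner t p)) (image (last-partner t 2+t≡a))
    ...   | inj₁ isBack = isBack
    ...   | inj₂ same = ⊥-elim (different-cols {suc t} {suc t} {suc t} {suc (suc t)} (≤-down p) p (m≢1+n+m (suc t) {0}) same)

  row : ∀ t → suc (suc t) ≤ a → ℕ
  row t p = Tgt.I (proj₁ (image-back t p))

  first : 2 ≤ a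
  first = s≤s (s≤s z≤n)

  r₀ : ℕ
  r₀ = row 0 first

  -- Consecutive back edges e_t, e_{t+1} induce a 2K₂, so their image rows
  -- differ by one; hence r_t stays within distance t of r₀.
  drift : ∀ t (p : suc (suc t) ≤ a) → row t p ≤ r₀ + t × r₀ ≤ row t p + t
  drift zero p rewrite cong toℕ (Tgt.crossing-row-unique (proj₁ (image-back 0 p)) (proj₁ (image-back 0 first))) =
    ≤-reflexive (sym (+-identityʳ r₀)) , ≤-reflexive (sym (+-identityʳ r₀))
  drift (suc t) p with drift t (≤-down p) | Tgt.consecutive-back (image (next-partner t p)) (image-back t (≤-down p)) (image-back (suc t) p)
  ... | (below , above) | inj₁ up rewrite up =
    ≤-trans (s≤s below) (≤-reflexive (sym (+-suc r₀ t))) , ≤-trans above (+-mono-≤ (n≤1+n _) (n≤1+n t))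
  ... | (below , above) | inj₂ down rewrite down =
    ≤-trans (n≤1+n _) (≤-trans below (+-monoʳ-≤ r₀ (n≤1+n t))) , ≤-trans above (≤-reflexive (sym (+-suc _ t)))

  last : suc (suc (suc c)) ≤ a
  last = ≤-refl

  rₗ : ℕ
  rₗ = row (suc c) last

  -- e_0 = x_2 y_0 has the three partners x_0 y_1, x_1 y_1 and x_3 y_1 through
  -- y_1, so its image is not in a middle row of Γ b.
  first-end : r₀ ≡ 2 ⊎ r₀ ≡ b
  first-end = Tgt.back-row-range (image-back 0 first) λ (3≤r , r<b) →
    Tgt.no-three-partners (image-back 0 first) 3≤r r<b
      (image asc-partner) (image (diag-partner 0 first)) (image (next-partner 0 third))
      (different-rows {0} {1} z≤n (s≤s z≤n) (λ ()))
      (different-rows {0} {3} z≤n third (λ ()))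
      (different-rows {1} {3} (s≤s z≤n) third (λ ()))
      (inj₂ refl) (inj₂ refl) (inj₂ refl)
    where
    third : 3 ≤ a
    third = s≤s (s≤s (s≤s z≤n))
    asc-partner : Induced2K2 (Γ a) (x 2) (y 0) (x 0) (y 1)
    asc-partner = index2K2 first z≤n z≤n (s≤s z≤n) (back refl) (asc (s≤s z≤n))
                    (unlinked-1 1) (unlinked z≤n (λ ()) (λ _ → inj₁ refl))

  -- e_{c+1} has the three partners x_{c+2} y_{c+3}, x_{c+2} y_{c+2} and
  -- x_{c+2} y_c through x_{c+2}.
  last-end : rₗ ≡ 2 ⊎ rₗ ≡ b
  last-end = Tgt.back-row-range (image-back (suc c) last) λ (3≤r , r<b) →
    Tgt.no-three-partners (image-back (suc c) last) 3≤r r<b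
      (image (last-partner (suc c) refl)) (image (diag-partner (suc c) last)) (image (2K2-swap (next-partner c last)))
      (different-cols {t = suc (suc (suc c))} {suc (suc c)} last (≤-down last) (λ e → m≢1+n+m (suc (suc c)) {0} (sym e)))
      (different-cols {t = suc (suc (suc c))} {c} last (≤-down (≤-down (≤-down last))) (λ e → m≢1+n+m c {2} (sym e)))
      (different-cols {t = suc (suc c)} {c} (≤-down last) (≤-down (≤-down (≤-down last))) (λ e → m≢1+n+m c {1} (sym e)))
      (inj₁ refl) (inj₁ refl) (inj₁ refl)

  -- The images of e_0 and e_{c+1} are different back edges, hence in
  -- different rows (the row vertex would be shared).
  ends-distinct : r₀ ≢ rₗ
  ends-distinct r₀≡rₗ with image-back 0 first | image-back (suc c) last | toℕ-injective r₀≡rₗ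
  ... | b₀ | bₗ | same-row =
    different-rows {2} {suc (suc (suc c))} {0} {suc c} first last (λ ())
      (Tgt.BackMatching.marked-shared b₀ bₗ (Tgt.row-end (proj₁ b₀))
        (subst (λ r → Tgt.X r ≡ φ (x a) ⊎ Tgt.X r ≡ φ (y (suc c))) (sym same-row) (Tgt.row-end (proj₁ bₗ))))

  impossible : ⊥
  impossible with drift (suc c) last | first-end | last-end
  ... | _ | inj₁ r₀≡2 | inj₁ rₗ≡2 = ends-distinct (trans r₀≡2 (sym rₗ≡2))
  ... | _ | inj₂ r₀≡b | inj₂ rₗ≡b = ends-distinct (trans r₀≡b (sym rₗ≡b))
  ... | (rₗ≤r₀+t , _) | inj₁ r₀≡2 | inj₂ rₗ≡b =
    <⇒≱ a<b (subst₂ (λ r r' → r ≤ r' + suc c) rₗ≡b r₀≡2 rₗ≤r₀+t)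
  ... | (_ , r₀≤rₗ+t) | inj₂ r₀≡b | inj₁ rₗ≡2 =
    <⇒≱ a<b (subst₂ (λ r r' → r ≤ r' + suc c) r₀≡b rₗ≡2 r₀≤rₗ+t)

family : ℕ → Graph
family k = Γ (suc (suc (suc k)))

family-in-class : ∀ k → InClass (family k)
family-in-class k = Γ-biconvex _ , Γ-P8-free _ , Γ-P̃8-free _ (s≤s (s≤s (s≤s z≤n)))

family-incomparable : ∀ i j → i ≢ j → ¬ (family i ≤ᵢ family j)
family-incomparable i j i≢j emb with <-cmp i j
... | tri< i<j _ _ = NoEmbedding.impossible i (suc (suc (suc j))) (s≤s (s≤s (s≤s i<j))) emb
... | tri≈ _ i≡j _ = i≢j i≡j
... | tri> _ _ j<i = <⇒≱ (+-mono-< larger larger) (embedding-size {family i} {family j} emb)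
  where
  larger : suc (suc (suc (suc j))) < suc (suc (suc (suc i)))
  larger = s≤s (s≤s (s≤s (s≤s j<i)))

mainTheorem2 : InfiniteAntichainIn InClass
mainTheorem2 = family , family-in-class , family-incomparable
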